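{- (i) For any positive integers $a,r$, there exists an $(ra^2,2,ra,r)$-PSEDF in $\mathbb{Z}_{ra^2}$. (ii) For any positive integer $\lambda$ and any positive integer $a$, there exists a non-disjoint $(\lambda a^2,2,\lambda a,\lambda)$-SEDF in $\mathbb{Z}_{\lambda a^2}$. (iii) For any positive integer $k$, the sets $\{0,1,\ldots,k-1\}$ and $\{0,k,2k,\ldots,(k-1)k\}$ form a non-disjoint $(k^2,2,k,1)$-SEDF in $\mathbb{Z}_{k^2}$.
   Context: Groups are written additively. For subsets $A,B$ of a group $G$, $\Delta(A,B)$ denotes the multiset $\{a-b: a\in A, b\in B\}$. For a group $G$ of order $v$ and $m>1$, a family of $k$-subsets $\{A_1,\ldots,A_m\}$ of $G$ is a $(v,m,k,\lambda)$-PSEDF if for every pair $i\neq j$ the multiset $\Delta(A_i,A_j)$ contains every element of $G$ exactly $\lambda$ times. It is a non-disjoint $(v,m,k,\lambda)$-SEDF if for each $i$ the multiset union $\bigcup_{j\neq i}\Delta(A_i,A_j)$ contains every element of $G$ (including $0$) exactly $\lambda$ times. -}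

module Defs where

open import Data.Nat using (ℕ; zero; suc; _+_; _∸_; _*_)
open import Data.Nat.DivMod using (_mod_)
open import Data.Fin using (Fin; toℕ; _≟_)
import Data.Fin as Fin
import Data.List
open import Data.List using (List; map; concatMap; filter; length; allFin)
open import Data.List.Relation.Unary.Unique.Propositional using (Unique)
open import Relation.Binary.PropositionalEquality using (_≡_)
open import Relation.Nullary using (¬_)
open import Data.Product using (_×_)
open import Relation.Nullary.Decidable using (¬?)

-- The cyclic group ℤ_v is modelled as Fin v; subtraction modulo v.
-- (Fin 0 is empty, so the zero case is vacuous.)
_⊖_ : ∀ {v} → Fin v → Fin v → Fin v
_⊖_ {suc n} x y = (toℕ x + (suc n ∸ toℕ y)) mod (suc n)

-- A subset of ℤ_v is a duplicate-free list; a k-subset additionally has length k.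
IsKSubset : ∀ {v} → ℕ → List (Fin v) → Set
IsKSubset k A = Unique A × length A ≡ k

Δ : ∀ {v} → List (Fin v) → List (Fin v) → List (Fin v)
Δ A B = concatMap (λ a → map (λ b → a ⊖ b) B) A

mult : ∀ {v} → Fin v → List (Fin v) → ℕ
mult g xs = length (filter (g ≟_) xs)

EveryElemTimes : ∀ {v} → ℕ → List (Fin v) → Set
EveryElemTimes {v} λ' xs = (g : Fin v) → mult g xs ≡ λ'

record IsPSEDF (v m k λ' : ℕ) (A : Fin m → List (Fin v)) : Set where
  field
    m>1     : 1 Data.Nat.< m
    ksubset : (i : Fin m) → IsKSubset k (A i)
    pairs   : (i j : Fin m) → ¬ (i ≡ j) → EveryElemTimes λ' (Δ (A i) (A j))

ΔOthers : ∀ {v m} → (Fin m → List (Fin v)) → Fin m → List (Fin v)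
ΔOthers {m = m} A i = concatMap (λ j → Δ (A i) (A j)) (filter (λ j → ¬? (i ≟ j)) (allFin m))

record IsSEDF (v m k λ' : ℕ) (A : Fin m → List (Fin v)) : Set where
  field
    m>1     : 1 Data.Nat.< m
    ksubset : (i : Fin m) → IsKSubset k (A i)
    unions  : (i : Fin m) → EveryElemTimes λ' (ΔOthers A i)

-- The family of part (iii): A₀ = {0,1,…,k-1}, A₁ = {0,k,2k,…,(k-1)k} in ℤ_{k²}
-- (all listed naturals are < k², so `mod` is just the embedding into Fin (k*k)).
SEDF-example : (k : ℕ) → 1 Data.Nat.≤ k → Fin 2 → List (Fin (k * k))
SEDF-example (suc n) _ Fin.zero = map (λ i → i mod (suc n * suc n)) (Data.List.upTo (suc n))
SEDF-example (suc n) _ (Fin.suc Fin.zero) = map (λ i → (i * suc n) mod (suc n * suc n)) (Data.List.upTo (suc n))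

{-# OPTIONS --safe #-}
module Submission where

-- Let n = c·a and v = n·a, and take A₀ = {0,1,…,n−1}, A₁ = {0,a,2a,…,(n−1)a} in ℤ_v.
-- An element h of ℤ_v equals i − ja with i ∈ A₀ exactly when (h + ja) mod v < n.
-- Writing h = qa + s with s < a, we get (h + ja) mod v = ((q + j) mod n)·a + s, which
-- is below n = c·a iff (q + j) mod n < c; as j runs through ℤ_n this happens exactly
-- c times. The same count applied to −h handles Δ(A₁, A₀). Parts (i) and (ii) take
-- c = r resp. c = λ; part (iii) is the case c = 1, a = k.

open import Defs
open import Data.Nat using (ℕ; zero; suc; pred; _+_; _*_; _∸_; _≤_; _<_; z≤n; s≤s; z<s; s<s; s<s⁻¹; NonZero; _≟_; _<?_)
open import Data.Nat.Properties
open import Data.Nat.DivMod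
open import Algebra.Properties.CommutativeSemigroup +-commutativeSemigroup using (interchange)
open import Data.Nat.Tactic.RingSolver using (solve-∀)
open import Data.Fin using (Fin; toℕ; zero; suc) renaming (_≟_ to _≟ᶠ_)
open import Data.Fin.Properties using (toℕ<n; toℕ-fromℕ<; toℕ-injective)
open import Data.List using (List; _++_; map; concatMap; filter; length; applyUpTo; upTo)
open import Data.List.Properties using (length-++; filter-++; map-applyUpTo; length-map; length-upTo; ++-identityʳ)
open import Data.List.Relation.Unary.Unique.Propositional using (Unique)
open import Data.List.Relation.Unary.Unique.Propositional.Properties using (applyUpTo⁺₁)
open import Data.Vec using (_∷_; []; lookup)
open import Data.Product using (Σ; _×_; _,_)
open import Data.Empty using (⊥-elim)
open import Function using (_∘_; _⇔_; mk⇔; Equivalence)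
open import Function.Properties.Equivalence using () renaming (trans to ⇔-trans)
open import Relation.Binary.PropositionalEquality
open import Relation.Nullary using (Dec; yes; no; ¬_; contradiction)
open import Relation.Unary using (Pred; Decidable)

open Equivalence using (to; from)

∑ : ℕ → (ℕ → ℕ) → ℕ
∑ zero    f = 0
∑ (suc n) f = f 0 + ∑ n (f ∘ suc)

syntax ∑ n (λ i → e) = ∑[ i < n ] e

∑-cong : ∀ n {f g : ℕ → ℕ} → (∀ {i} → i < n → f i ≡ g i) → ∑ n f ≡ ∑ n g
∑-cong zero    f≗g = refl
∑-cong (suc n) f≗g = cong₂ _+_ (f≗g z<s) (∑-cong n (f≗g ∘ s<s))

∑-zero : ∀ n → ∑[ i < n ] 0 ≡ 0
∑-zero zero    = refl
∑-zero (suc n) = ∑-zero n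

∑-distrib-+ : ∀ n (f g : ℕ → ℕ) → ∑[ i < n ] (f i + g i) ≡ ∑ n f + ∑ n g
∑-distrib-+ zero    f g = refl
∑-distrib-+ (suc n) f g =
  trans (cong (f 0 + g 0 +_) (∑-distrib-+ n (f ∘ suc) (g ∘ suc))) (interchange (f 0) (g 0) _ _)

∑-comm : ∀ m n (f : ℕ → ℕ → ℕ) → ∑[ i < m ] ∑[ j < n ] f i j ≡ ∑[ j < n ] ∑[ i < m ] f i j
∑-comm zero    n f = sym (∑-zero n)
∑-comm (suc m) n f = begin
  ∑ n (f 0) + ∑[ i < m ] ∑[ j < n ] f (suc i) j ≡⟨ cong (∑ n (f 0) +_) (∑-comm m n (f ∘ suc)) ⟩
  ∑ n (f 0) + ∑[ j < n ] ∑[ i < m ] f (suc i) j ≡⟨ ∑-distrib-+ n (f 0) _ ⟨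
  ∑[ j < n ] ∑[ i < suc m ] f i j               ∎
  where open ≡-Reasoning

∑-suc : ∀ n f → ∑ (suc n) f ≡ ∑ n f + f n
∑-suc zero    f = +-comm (f 0) 0
∑-suc (suc n) f = trans (cong (f 0 +_) (∑-suc n (f ∘ suc))) (sym (+-assoc (f 0) _ _))

∑-shift : ∀ n (f : ℕ → ℕ) → f n ≡ f 0 → ∑ n (f ∘ suc) ≡ ∑ n f
∑-shift zero    f fn≡f0 = refl
∑-shift (suc n) f fn≡f0 = begin
  ∑ (suc n) (f ∘ suc)       ≡⟨ ∑-suc n (f ∘ suc) ⟩
  ∑ n (f ∘ suc) + f (suc n) ≡⟨ cong (∑ n (f ∘ suc) +_) fn≡f0 ⟩
  ∑ n (f ∘ suc) + f 0       ≡⟨ +-comm _ (f 0) ⟩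
  ∑ (suc n) f               ∎
  where open ≡-Reasoning

∑-rotate : ∀ n .{{_ : NonZero n}} q (f : ℕ → ℕ) → ∑[ j < n ] f ((q + j) % n) ≡ ∑ n f
∑-rotate n zero    f = ∑-cong n (cong f ∘ m<n⇒m%n≡m)
∑-rotate n (suc q) f = begin
  ∑[ j < n ] f ((suc q + j) % n) ≡⟨ ∑-cong n (λ {j} _ → cong (f ∘ (_% n)) (sym (+-suc q j))) ⟩
  ∑[ j < n ] f ((q + suc j) % n) ≡⟨ ∑-shift n (λ j → f ((q + j) % n)) (cong f q+n%n≡q+0%n) ⟩
  ∑[ j < n ] f ((q + j) % n)     ≡⟨ ∑-rotate n q f ⟩
  ∑ n f                          ∎
  where
  open ≡-Reasoning
  q+n%n≡q+0%n : (q + n) % n ≡ (q + 0) % n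
  q+n%n≡q+0%n = trans ([m+n]%n≡m%n q n) (cong (_% n) (sym (+-identityʳ q)))

𝟙 : ∀ {p} {P : Set p} → Dec P → ℕ
𝟙 (yes _) = 1
𝟙 (no _)  = 0

𝟙-cong : ∀ {p q} {P : Set p} {Q : Set q} → P ⇔ Q → (P? : Dec P) (Q? : Dec Q) → 𝟙 P? ≡ 𝟙 Q?
𝟙-cong P⇔Q (yes _)  (yes _)  = refl
𝟙-cong P⇔Q (yes p)  (no ¬q)  = contradiction (to P⇔Q p) ¬q
𝟙-cong P⇔Q (no ¬p)  (yes q)  = contradiction (from P⇔Q q) ¬p
𝟙-cong P⇔Q (no _)   (no _)   = refl

𝟙-yes : ∀ {p} {P : Set p} → P → (P? : Dec P) → 𝟙 P? ≡ 1
𝟙-yes p (yes _) = refl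
𝟙-yes p (no ¬p) = contradiction p ¬p

𝟙-no : ∀ {p} {P : Set p} → ¬ P → (P? : Dec P) → 𝟙 P? ≡ 0
𝟙-no ¬p (yes p) = contradiction p ¬p
𝟙-no ¬p (no _)  = refl

∑-𝟙-≡ : ∀ n m → ∑[ i < n ] 𝟙 (m ≟ i) ≡ 𝟙 (m <? n)
∑-𝟙-≡ zero    m       = sym (𝟙-no (λ ()) (m <? 0))
∑-𝟙-≡ (suc n) zero    = begin
  1 + ∑[ i < n ] 𝟙 (0 ≟ suc i) ≡⟨ cong suc (∑-cong n (λ {i} _ → 𝟙-no (λ ()) (0 ≟ suc i))) ⟩
  1 + ∑[ i < n ] 0             ≡⟨ cong suc (∑-zero n) ⟩
  1                            ≡⟨ 𝟙-yes z<s (0 <? suc n) ⟨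
  𝟙 (0 <? suc n)               ∎
  where open ≡-Reasoning
∑-𝟙-≡ (suc n) (suc m) = begin
  ∑[ i < n ] 𝟙 (suc m ≟ suc i) ≡⟨ ∑-cong n (λ {i} _ → 𝟙-cong (mk⇔ suc-injective (cong suc)) (suc m ≟ suc i) (m ≟ i)) ⟩
  ∑[ i < n ] 𝟙 (m ≟ i)         ≡⟨ ∑-𝟙-≡ n m ⟩
  𝟙 (m <? n)                   ≡⟨ 𝟙-cong (mk⇔ s<s s<s⁻¹) (m <? n) (suc m <? suc n) ⟩
  𝟙 (suc m <? suc n)           ∎
  where open ≡-Reasoning

∑-𝟙-< : ∀ n c → c ≤ n → ∑[ t < n ] 𝟙 (t <? c) ≡ c
∑-𝟙-< n       zero    _         = trans (∑-cong n (λ {t} _ → 𝟙-no (λ ()) (t <? 0))) (∑-zero n)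
∑-𝟙-< (suc n) (suc c) (s≤s c≤n) =
  cong suc (trans (∑-cong n (λ {t} _ → 𝟙-cong (mk⇔ s<s⁻¹ s<s) (suc t <? suc c) (t <? c))) (∑-𝟙-< n c c≤n))

module _ {a p} {A : Set a} {P : Pred A p} (P? : Decidable P) where

  length-filter-applyUpTo : ∀ (f : ℕ → A) n → length (filter P? (applyUpTo f n)) ≡ ∑[ i < n ] 𝟙 (P? (f i))
  length-filter-applyUpTo f zero = refl
  length-filter-applyUpTo f (suc n) with P? (f 0)
  ... | yes _ = cong suc (length-filter-applyUpTo (f ∘ suc) n)
  ... | no _  = length-filter-applyUpTo (f ∘ suc) n

  length-filter-concatMap-applyUpTo : ∀ {b} {B : Set b} (F : B → List A) (f : ℕ → B) n →
    length (filter P? (concatMap F (applyUpTo f n))) ≡ ∑[ i < n ] length (filter P? (F (f i)))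
  length-filter-concatMap-applyUpTo F f zero    = refl
  length-filter-concatMap-applyUpTo F f (suc n) = begin
    length (filter P? (F (f 0) ++ concatMap F (applyUpTo (f ∘ suc) n)))
      ≡⟨ cong length (filter-++ P? (F (f 0)) _) ⟩
    length (filter P? (F (f 0)) ++ filter P? (concatMap F (applyUpTo (f ∘ suc) n)))
      ≡⟨ length-++ (filter P? (F (f 0))) ⟩
    length (filter P? (F (f 0))) + length (filter P? (concatMap F (applyUpTo (f ∘ suc) n)))
      ≡⟨ cong (length (filter P? (F (f 0))) +_) (length-filter-concatMap-applyUpTo F (f ∘ suc) n) ⟩
    ∑[ i < suc n ] length (filter P? (F (f i)))
      ∎
    where
    open ≡-Reasoning

mult-Δ-upTo : ∀ {v} (g : Fin v) (f h : ℕ → Fin v) m n →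
  mult g (Δ (map f (upTo m)) (map h (upTo n))) ≡ ∑[ i < m ] ∑[ j < n ] 𝟙 (g ≟ᶠ f i ⊖ h j)
mult-Δ-upTo g f h m n = begin
  length (filter (g ≟ᶠ_) (concatMap (λ x → map (x ⊖_) (map h (upTo n))) (map f (upTo m))))
    ≡⟨ cong (λ xs → length (filter (g ≟ᶠ_) (concatMap _ xs))) (map-applyUpTo _ f m) ⟩
  length (filter (g ≟ᶠ_) (concatMap (λ x → map (x ⊖_) (map h (upTo n))) (applyUpTo f m)))
    ≡⟨ length-filter-concatMap-applyUpTo (g ≟ᶠ_) _ f m ⟩
  ∑[ i < m ] length (filter (g ≟ᶠ_) (map (f i ⊖_) (map h (upTo n))))
    ≡⟨ ∑-cong m (λ {i} _ → cong (length ∘ filter (g ≟ᶠ_)) (applyUpTo-twice i)) ⟩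
  ∑[ i < m ] length (filter (g ≟ᶠ_) (applyUpTo (λ j → f i ⊖ h j) n))
    ≡⟨ ∑-cong m (λ {i} _ → length-filter-applyUpTo (g ≟ᶠ_) _ n) ⟩
  ∑[ i < m ] ∑[ j < n ] 𝟙 (g ≟ᶠ f i ⊖ h j)
    ∎
  where
  open ≡-Reasoning
  applyUpTo-twice : ∀ i → map (f i ⊖_) (map h (upTo n)) ≡ applyUpTo (λ j → f i ⊖ h j) n
  applyUpTo-twice i = trans (cong (map (f i ⊖_)) (map-applyUpTo _ h n)) (map-applyUpTo h (f i ⊖_) n)

IsKSubset-map-upTo : ∀ {v} (f : ℕ → Fin v) n → (∀ {i j} → i < j → j < n → f i ≡ f j → i ≡ j) →
  IsKSubset n (map f (upTo n))
IsKSubset-map-upTo f n f-injective =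
  subst Unique (sym (map-applyUpTo _ f n)) (applyUpTo⁺₁ f n (λ i<j j<n → <⇒≢ i<j ∘ f-injective i<j j<n)) ,
  trans (length-map f (upTo n)) (length-upTo n)

[m*n+o]%[p*n]≡[m%p]*n+o : ∀ m {n o} p .{{_ : NonZero p}} .{{_ : NonZero (p * n)}} → o < n →
  (m * n + o) % (p * n) ≡ m % p * n + o
[m*n+o]%[p*n]≡[m%p]*n+o m {n} p o<n =
  trans ([m*n+o]%[p*n]≡[m*n]%[p*n]+o m p o<n) (cong (_+ _) (sym (m%n*o≡m*o%[n*o] m p n)))

t*a+s<c*a⇔t<c : ∀ {a s} t c → s < a → (t * a + s < c * a ⇔ t < c)
t*a+s<c*a⇔t<c {a} {s} t c s<a = mk⇔
  (λ lt → *-cancelʳ-< a t c (≤-<-trans (m≤m+n (t * a) s) lt))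
  (λ t<c → begin-strict
    t * a + s <⟨ +-monoʳ-< (t * a) s<a ⟩
    t * a + a ≡⟨ +-comm (t * a) a ⟩
    suc t * a ≤⟨ *-monoˡ-≤ a t<c ⟩
    c * a     ∎)
  where open ≤-Reasoning

[x+y]%v≡z⇔[z+[v∸y]]%v≡x : ∀ {x y z v} .{{_ : NonZero v}} → x < v → y ≤ v → z < v →
  ((x + y) % v ≡ z ⇔ (z + (v ∸ y)) % v ≡ x)
[x+y]%v≡z⇔[z+[v∸y]]%v≡x {x} {y} {z} {v} x<v y≤v z<v = mk⇔
  (λ { refl → begin
    ((x + y) % v + (v ∸ y)) % v ≡⟨ [m%v+k]%v≡[m+k]%v (x + y) (v ∸ y) ⟩
    (x + y + (v ∸ y)) % v       ≡⟨ cong (_% v) (+-assoc x y (v ∸ y)) ⟩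
    (x + (y + (v ∸ y))) % v     ≡⟨ cong (λ u → (x + u) % v) (m+[n∸m]≡n y≤v) ⟩
    (x + v) % v                 ≡⟨ [m+n]%n≡m%n x v ⟩
    x % v                       ≡⟨ m<n⇒m%n≡m x<v ⟩
    x                           ∎ })
  (λ { refl → begin
    ((z + (v ∸ y)) % v + y) % v ≡⟨ [m%v+k]%v≡[m+k]%v (z + (v ∸ y)) y ⟩
    (z + (v ∸ y) + y) % v       ≡⟨ cong (_% v) (+-assoc z (v ∸ y) y) ⟩
    (z + (v ∸ y + y)) % v       ≡⟨ cong (λ u → (z + u) % v) (m∸n+n≡m y≤v) ⟩
    (z + v) % v                 ≡⟨ [m+n]%n≡m%n z v ⟩
    z % v                       ≡⟨ m<n⇒m%n≡m z<v ⟩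
    z                           ∎ })
  where
  open ≡-Reasoning
  [m%v+k]%v≡[m+k]%v : ∀ m k → (m % v + k) % v ≡ (m + k) % v
  [m%v+k]%v≡[m+k]%v m k = begin
    (m % v + k) % v           ≡⟨ %-distribˡ-+ (m % v) k v ⟩
    (m % v % v + k % v) % v   ≡⟨ cong (λ u → (u + k % v) % v) (m%n%n≡m%n m v) ⟩
    (m % v + k % v) % v       ≡⟨ %-distribˡ-+ m k v ⟨
    (m + k) % v               ∎

toℕ-mod : ∀ m n .{{_ : NonZero n}} → toℕ (m mod n) ≡ m % n
toℕ-mod m n = toℕ-fromℕ< (m%n<n m n)

m<n⇒toℕ-mod≡m : ∀ {m n} .{{_ : NonZero n}} → m < n → toℕ (m mod n) ≡ m
m<n⇒toℕ-mod≡m {m} {n} m<n = trans (toℕ-mod m n) (m<n⇒m%n≡m m<n)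

≡⊖⇔ : ∀ {w} (g X Y : Fin (suc w)) → (g ≡ X ⊖ Y ⇔ (toℕ g + toℕ Y) % suc w ≡ toℕ X)
≡⊖⇔ {w} g X Y = ⇔-trans toℕ-≡⇔ (mk⇔ (from lemma ∘ sym) (sym ∘ to lemma))
  where
  lemma = [x+y]%v≡z⇔[z+[v∸y]]%v≡x (toℕ<n g) (<⇒≤ (toℕ<n Y)) (toℕ<n X)
  toℕ-≡⇔ : g ≡ X ⊖ Y ⇔ toℕ g ≡ (toℕ X + (suc w ∸ toℕ Y)) % suc w
  toℕ-≡⇔ = mk⇔ (λ { refl → toℕ-X⊖Y }) (λ eq → toℕ-injective (trans eq (sym toℕ-X⊖Y)))
    where toℕ-X⊖Y = toℕ-mod (toℕ X + (suc w ∸ toℕ Y)) (suc w)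

IsPSEDF-pair : ∀ {v k λ'} (F : Fin 2 → List (Fin v)) →
  IsKSubset k (F zero) → IsKSubset k (F (suc zero)) →
  EveryElemTimes λ' (Δ (F zero) (F (suc zero))) → EveryElemTimes λ' (Δ (F (suc zero)) (F zero)) →
  IsPSEDF v 2 k λ' F
IsPSEDF-pair F F₀-subset F₁-subset Δ₀₁ Δ₁₀ = record
  { m>1 = s≤s (s≤s z≤n) ; ksubset = λ { zero → F₀-subset ; (suc zero) → F₁-subset } ; pairs = pairs }
  where
  pairs : ∀ i j → ¬ i ≡ j → EveryElemTimes _ (Δ (F i) (F j))
  pairs zero       zero       i≢j = ⊥-elim (i≢j refl)
  pairs zero       (suc zero) _   = Δ₀₁
  pairs (suc zero) zero       _   = Δ₁₀
  pairs (suc zero) (suc zero) i≢j = ⊥-elim (i≢j refl)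

IsSEDF-pair : ∀ {v k λ'} (F : Fin 2 → List (Fin v)) →
  IsKSubset k (F zero) → IsKSubset k (F (suc zero)) →
  EveryElemTimes λ' (Δ (F zero) (F (suc zero))) → EveryElemTimes λ' (Δ (F (suc zero)) (F zero)) →
  IsSEDF v 2 k λ' F
IsSEDF-pair F F₀-subset F₁-subset Δ₀₁ Δ₁₀ = record
  { m>1 = s≤s (s≤s z≤n) ; ksubset = λ { zero → F₀-subset ; (suc zero) → F₁-subset } ; unions = unions }
  where
  unions : ∀ i → EveryElemTimes _ (ΔOthers F i)
  unions zero       g = trans (cong (mult g) (++-identityʳ (Δ (F zero) (F (suc zero))))) (Δ₀₁ g)
  unions (suc zero) g = trans (cong (mult g) (++-identityʳ (Δ (F (suc zero)) (F zero)))) (Δ₁₀ g)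

-- v = suc w and n are related to a and c only propositionally: ⊖ computes only on
-- Fin (suc w), and part (iii) has n = k rather than 1 · k.
module Construction (a c n w : ℕ) .{{_ : NonZero a}} .{{_ : NonZero c}}
                    (n≡c*a : n ≡ c * a) (v≡n*a : suc w ≡ n * a) where

  private
    v = suc w

  instance
    n≢0 : NonZero n
    n≢0 = subst NonZero (sym n≡c*a) (m*n≢0 c a)

    n*a≢0 : NonZero (n * a)
    n*a≢0 = m*n≢0 n a

  n≤v : n ≤ v
  n≤v = subst (n ≤_) (sym v≡n*a) (m≤m*n n a)

  j*a<v : ∀ {j} → j < n → j * a < v
  j*a<v {j} j<n = subst (j * a <_) (sym v≡n*a) (*-monoˡ-< a j<n)

  [H+j*a]%v≡[[H/a+j]%n]*a+H%a : ∀ H j → (H + j * a) % v ≡ (H / a + j) % n * a + H % a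
  [H+j*a]%v≡[[H/a+j]%n]*a+H%a H j = begin
    (H + j * a) % v                       ≡⟨ %-congʳ v≡n*a ⟩
    (H + j * a) % (n * a)                 ≡⟨ cong (λ m → (m + j * a) % (n * a)) (m≡m%n+[m/n]*n H a) ⟩
    (H % a + H / a * a + j * a) % (n * a) ≡⟨ cong (_% (n * a)) (regroup (H % a) (H / a) j a) ⟩
    ((H / a + j) * a + H % a) % (n * a)   ≡⟨ [m*n+o]%[p*n]≡[m%p]*n+o (H / a + j) n (m%n<n H a) ⟩
    (H / a + j) % n * a + H % a           ∎
    where
    open ≡-Reasoning
    regroup : ∀ s q j a → s + q * a + j * a ≡ (q + j) * a + s
    regroup = solve-∀

  shifted-count : ∀ H → ∑[ j < n ] ∑[ i < n ] 𝟙 ((H + j * a) % v ≟ i) ≡ c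
  shifted-count H = begin
    ∑[ j < n ] ∑[ i < n ] 𝟙 ((H + j * a) % v ≟ i) ≡⟨ ∑-cong n (λ {j} _ → ∑-𝟙-≡ n ((H + j * a) % v)) ⟩
    ∑[ j < n ] 𝟙 ((H + j * a) % v <? n)           ≡⟨ ∑-cong n (λ {j} _ → 𝟙-cong (below-n⇔ j) _ _) ⟩
    ∑[ j < n ] 𝟙 ((H / a + j) % n <? c)           ≡⟨ ∑-rotate n (H / a) (λ t → 𝟙 (t <? c)) ⟩
    ∑[ t < n ] 𝟙 (t <? c)                         ≡⟨ ∑-𝟙-< n c (subst (c ≤_) (sym n≡c*a) (m≤m*n c a)) ⟩
    c                                             ∎
    where
    open ≡-Reasoning
    below-n⇔ : ∀ j → ((H + j * a) % v < n ⇔ (H / a + j) % n < c)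
    below-n⇔ j = subst₂ (λ x y → (x < y) ⇔ (H / a + j) % n < c)
                        (sym ([H+j*a]%v≡[[H/a+j]%n]*a+H%a H j)) (sym n≡c*a)
                        (t*a+s<c*a⇔t<c ((H / a + j) % n) c (m%n<n H a))

  A₀ A₁ : List (Fin v)
  A₀ = map (λ i → i mod v) (upTo n)
  A₁ = map (λ j → (j * a) mod v) (upTo n)

  A₀-isKSubset : IsKSubset n A₀
  A₀-isKSubset = IsKSubset-map-upTo _ n λ i<j j<n eq →
    trans (sym (m<n⇒toℕ-mod≡m (<-≤-trans (<-trans i<j j<n) n≤v))) (trans (cong toℕ eq) (m<n⇒toℕ-mod≡m (<-≤-trans j<n n≤v)))

  A₁-isKSubset : IsKSubset n A₁
  A₁-isKSubset = IsKSubset-map-upTo _ n λ {i} {j} i<j j<n eq → *-cancelʳ-≡ i j a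
    (trans (sym (m<n⇒toℕ-mod≡m (j*a<v (<-trans i<j j<n)))) (trans (cong toℕ eq) (m<n⇒toℕ-mod≡m (j*a<v j<n))))

  Δ-A₀-A₁ : EveryElemTimes c (Δ A₀ A₁)
  Δ-A₀-A₁ g = begin
    mult g (Δ A₀ A₁)                                              ≡⟨ mult-Δ-upTo g _ _ n n ⟩
    ∑[ i < n ] ∑[ j < n ] 𝟙 (g ≟ᶠ (i mod v) ⊖ ((j * a) mod v))   ≡⟨ ∑-cong n (λ i<n → ∑-cong n (λ j<n → 𝟙-cong (summand⇔ i<n j<n) _ _)) ⟩
    ∑[ i < n ] ∑[ j < n ] 𝟙 ((toℕ g + j * a) % v ≟ i)             ≡⟨ ∑-comm n n _ ⟩
    ∑[ j < n ] ∑[ i < n ] 𝟙 ((toℕ g + j * a) % v ≟ i)             ≡⟨ shifted-count (toℕ g) ⟩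
    c                                                             ∎
    where
    open ≡-Reasoning
    summand⇔ : ∀ {i j} → i < n → j < n → (g ≡ (i mod v) ⊖ ((j * a) mod v) ⇔ (toℕ g + j * a) % v ≡ i)
    summand⇔ {i} {j} i<n j<n = subst₂ (λ x y → (g ≡ (i mod v) ⊖ ((j * a) mod v)) ⇔ (toℕ g + y) % v ≡ x)
      (m<n⇒toℕ-mod≡m (<-≤-trans i<n n≤v)) (m<n⇒toℕ-mod≡m (j*a<v j<n)) (≡⊖⇔ g _ _)

  Δ-A₁-A₀ : EveryElemTimes c (Δ A₁ A₀)
  Δ-A₁-A₀ g = begin
    mult g (Δ A₁ A₀)                                              ≡⟨ mult-Δ-upTo g _ _ n n ⟩
    ∑[ j < n ] ∑[ i < n ] 𝟙 (g ≟ᶠ ((j * a) mod v) ⊖ (i mod v))   ≡⟨ ∑-cong n (λ j<n → ∑-cong n (λ i<n → 𝟙-cong (summand⇔ i<n j<n) _ _)) ⟩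
    ∑[ j < n ] ∑[ i < n ] 𝟙 ((v ∸ toℕ g + j * a) % v ≟ i)         ≡⟨ shifted-count (v ∸ toℕ g) ⟩
    c                                                             ∎
    where
    open ≡-Reasoning
    summand⇔ : ∀ {i j} → i < n → j < n → (g ≡ ((j * a) mod v) ⊖ (i mod v) ⇔ (v ∸ toℕ g + j * a) % v ≡ i)
    summand⇔ {i} {j} i<n j<n = ⇔-trans
      (subst₂ (λ x y → (g ≡ ((j * a) mod v) ⊖ (i mod v)) ⇔ (toℕ g + y) % v ≡ x)
              (m<n⇒toℕ-mod≡m (j*a<v j<n)) (m<n⇒toℕ-mod≡m i<v) (≡⊖⇔ g _ _))
      (subst₂ (λ x y → (x % v ≡ j * a) ⇔ (y % v ≡ i)) (+-comm i (toℕ g)) (+-comm (j * a) (v ∸ toℕ g))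
              ([x+y]%v≡z⇔[z+[v∸y]]%v≡x i<v (<⇒≤ (toℕ<n g)) (j*a<v j<n)))
      where
      i<v = <-≤-trans i<n n≤v

  family : Fin 2 → List (Fin v)
  family = lookup (A₀ ∷ A₁ ∷ [])

  family-isPSEDF : IsPSEDF v 2 n c family
  family-isPSEDF = IsPSEDF-pair family A₀-isKSubset A₁-isKSubset Δ-A₀-A₁ Δ-A₁-A₀

  family-isSEDF : IsSEDF v 2 n c family
  family-isSEDF = IsSEDF-pair family A₀-isKSubset A₁-isKSubset Δ-A₀-A₁ Δ-A₁-A₀

mainTheorem4 :
    ((a r : ℕ) → 1 ≤ a → 1 ≤ r →
      Σ (Fin 2 → List (Fin (r * (a * a)))) (IsPSEDF (r * (a * a)) 2 (r * a) r))
    × ((λ' a : ℕ) → 1 ≤ λ' → 1 ≤ a →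
      Σ (Fin 2 → List (Fin (λ' * (a * a)))) (IsSEDF (λ' * (a * a)) 2 (λ' * a) λ'))
    × ((k : ℕ) → (k≥1 : 1 ≤ k) →
      IsSEDF (k * k) 2 k 1 (SEDF-example k k≥1))
mainTheorem4 = part-i , part-ii , part-iii
  where
  part-i : (a r : ℕ) → 1 ≤ a → 1 ≤ r →
    Σ (Fin 2 → List (Fin (r * (a * a)))) (IsPSEDF (r * (a * a)) 2 (r * a) r)
  part-i a@(suc _) r@(suc _) _ _ = family , family-isPSEDF
    where open Construction a r (r * a) (pred (r * (a * a))) refl (sym (*-assoc r a a))

  part-ii : (λ' a : ℕ) → 1 ≤ λ' → 1 ≤ a →
    Σ (Fin 2 → List (Fin (λ' * (a * a)))) (IsSEDF (λ' * (a * a)) 2 (λ' * a) λ')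
  part-ii λ'@(suc _) a@(suc _) _ _ = family , family-isSEDF
    where open Construction a λ' (λ' * a) (pred (λ' * (a * a))) refl (sym (*-assoc λ' a a))

  part-iii : (k : ℕ) → (k≥1 : 1 ≤ k) → IsSEDF (k * k) 2 k 1 (SEDF-example k k≥1)
  part-iii k@(suc _) k≥1 = IsSEDF-pair (SEDF-example k k≥1) A₀-isKSubset A₁-isKSubset Δ-A₀-A₁ Δ-A₁-A₀
    where open Construction k 1 k (pred (k * k)) (sym (*-identityˡ k)) refl
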